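{- For any integers $a,a'>1$, if $\mathrm{L}_a\cap\mathrm{L}_{a'}\neq\emptyset$ then $a\in\mathrm{L}_{a'}$ or $a'\in\mathrm{L}_a$. Consequently, either $\mathrm{L}_a\cap\mathrm{L}_{a'}=\emptyset$, or $\mathrm{L}_a\subset\mathrm{L}_{a'}$, or $\mathrm{L}_a\supset\mathrm{L}_{a'}$.
   Context: For an integer $a>1$ let $P(a)$ be its largest prime factor and $\mathrm{L}_a=\{ba : b\in\mathbb{N},\ \text{every prime } p\mid b \text{ satisfies } p\ge P(a)\}$. -}

module Defs where

open import Data.Nat using (ℕ; _*_; _≤_; _<_)
open import Data.Nat.Divisibility using (_∣_)
open import Data.Nat.Primality using (Prime)
open import Data.Product using (Σ; _×_; ∃)
open import Data.Empty using (⊥)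
open import Relation.Binary.PropositionalEquality using (_≡_)

IsLargestPrimeFactor : ℕ → ℕ → Set
IsLargestPrimeFactor a p = Prime p × p ∣ a × (∀ q → Prime q → q ∣ a → q ≤ p)

-- every prime factor of b is ≥ P(a)  (P(a) is unique when it exists, a > 1)
FactorsAbove : ℕ → ℕ → Set
FactorsAbove a b = ∀ P → IsLargestPrimeFactor a P → ∀ p → Prime p → p ∣ b → P ≤ p

_∈L_ : ℕ → ℕ → Set
n ∈L a = ∃ λ b → 1 ≤ b × n ≡ b * a × FactorsAbove a b

_⊆L_ : ℕ → ℕ → Set
a ⊆L a' = ∀ n → n ∈L a → n ∈L a'

DisjointL : ℕ → ℕ → Set
DisjointL a a' = ∀ n → n ∈L a → n ∈L a' → ⊥

{-# OPTIONS --safe #-}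
-- Write n = b a = b′ a′ with P = P(a), Q = P(a′), every prime of b at least P and every prime of b′
-- at least Q. Dividing a and a′ by their gcd leaves coprime cofactors α, α′ with b α = b′ α′,
-- hence α ∣ b′ and α′ ∣ b. A prime p of α and a prime q of α′ would satisfy
-- p ≤ P ≤ q ≤ Q ≤ p, so p = q divides both; thus α = 1 (and a ∣ a′ with cofactor α′ ∣ b) or
-- α′ = 1. The trichotomy follows because membership in L_a is transitive and decidable.
module Submission where

open import Defs
open import Data.List.Base using (_∷_)
open import Data.List.Extrema.Nat using (max; argmax-all; ⊥≤max; xs≤max)
open import Data.List.Membership.Propositional using (_∈_)
open import Data.List.Relation.Unary.All as All using ()
open import Data.List.Relation.Unary.Any using (here; there)
open import Data.Nat.Base
  using (ℕ; suc; _*_; _≤_; _<_; z<s; s<s; NonZero; ≢-nonZero; ≢-nonZero⁻¹; >-nonZero⁻¹)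
open import Data.Nat.Coprimality as Coprime using (Coprime; coprime-/gcd; coprime-divisor)
open import Data.Nat.Divisibility using (_∣_; divides; _∣?_; _∣0; ∣-trans; n∣m*n)
open import Data.Nat.DivMod using (_/_; m/n*n≡m)
open import Data.Nat.GCD using (gcd; gcd[m,n]∣m; gcd[m,n]∣n; gcd[m,n]≢0)
open import Data.Nat.ListAction.Properties using (∈⇒∣product)
open import Data.Nat.Primality using (Prime; prime[2]; ¬prime[1]; prime?; euclidsLemma)
open import Data.Nat.Primality.Factorisation using (factorise; factorisationHasAllPrimeFactors)
open import Data.Nat.Properties
  using ( _≟_; _≤?_; ≤-antisym; ≤-trans; ≮⇒≥; <⇒≱; allUpTo?
        ; *-assoc; *-comm; *-identityˡ; *-mono-≤; *-cancelʳ-≡; m*n≢0⇒m≢0)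
open import Data.Product using (_×_; _,_; proj₁; proj₂; ∃; ∃-syntax)
open import Data.Sum using (_⊎_; inj₁; inj₂; [_,_]′)
open import Function using (id; _∘_; it)
open import Relation.Nullary using (¬_; yes; no; ¬?; contradiction)
open import Relation.Nullary.Decidable using (Dec; map′; _×-dec_; _→-dec_)
open import Relation.Binary.PropositionalEquality
  using (_≡_; _≢_; refl; sym; trans; cong; subst; module ≡-Reasoning)

PrimeFactors≤ : ℕ → ℕ → Set
PrimeFactors≤ P a = ∀ p → Prime p → p ∣ a → p ≤ P

PrimeFactors≥ : ℕ → ℕ → Set
PrimeFactors≥ P b = ∀ p → Prime p → p ∣ b → P ≤ p

primeFactors≥? : ∀ P b → Dec (PrimeFactors≥ P b)
primeFactors≥? P b = map′ fromBounded toBounded (allUpTo? (λ p → prime? p →-dec ¬? (p ∣? b)) P)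
  where
  fromBounded : (∀ {p} → p < P → Prime p → ¬ p ∣ b) → PrimeFactors≥ P b
  fromBounded h p p-prime p∣b = ≮⇒≥ λ p<P → h p<P p-prime p∣b

  toBounded : PrimeFactors≥ P b → ∀ {p} → p < P → Prime p → ¬ p ∣ b
  toBounded h p<P p-prime p∣b = <⇒≱ p<P (h _ p-prime p∣b)

largestPrimeFactor : ∀ n → 1 < n → ∃ (IsLargestPrimeFactor n)
largestPrimeFactor n@(suc (suc _)) (s<s z<s) with factorise n
... | record { factors = p ∷ ps ; isFactorisation = n≡Π ; factorsPrime = primes } =
  max p ps , proj₁ maxDivisor , proj₂ maxDivisor , maximal
  where
  primeDivisor : ∀ {q} → q ∈ p ∷ ps → Prime q × q ∣ n
  primeDivisor {q} q∈ = All.lookup primes q∈ , subst (q ∣_) (sym n≡Π) (∈⇒∣product {ns = p ∷ ps} q∈)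

  maxDivisor : Prime (max p ps) × max p ps ∣ n
  maxDivisor = argmax-all id (primeDivisor (here refl)) (All.tabulate (primeDivisor ∘ there))

  maximal : PrimeFactors≤ (max p ps) n
  maximal q q-prime q∣n with factorisationHasAllPrimeFactors q-prime (subst (q ∣_) n≡Π q∣n) primes
  ... | here refl = ⊥≤max p ps
  ... | there q∈ps = All.lookup (xs≤max p ps) q∈ps

largestPrimeFactor-unique : ∀ {n P P′} → IsLargestPrimeFactor n P → IsLargestPrimeFactor n P′ → P ≡ P′
largestPrimeFactor-unique (P-prime , P∣n , P-max) (P′-prime , P′∣n , P′-max) =
  ≤-antisym (P′-max _ P-prime P∣n) (P-max _ P′-prime P′∣n)

primeFactor : ∀ {n} → n ≢ 1 → ∃[ p ] Prime p × p ∣ n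
primeFactor {0} _ = 2 , prime[2] , 2 ∣0
primeFactor {1} 1≢1 = contradiction refl 1≢1
primeFactor {n@(suc (suc _))} _ with largestPrimeFactor n (s<s z<s)
... | p , p-prime , p∣n , _ = p , p-prime , p∣n

coprime-cross-∣ : ∀ {α α′ b b′} → Coprime α α′ → b * α ≡ b′ * α′ → α ∣ b′ × α′ ∣ b
coprime-cross-∣ {α} {α′} {b} {b′} cop bα≡b′α′ =
  coprime-divisor cop (subst (α ∣_) (trans bα≡b′α′ (*-comm b′ α′)) (n∣m*n b)) ,
  coprime-divisor (Coprime.sym cop) (subst (α′ ∣_) (trans (sym bα≡b′α′) (*-comm b α)) (n∣m*n b′))

coprime-squeezed⇒≡1 : ∀ {P Q α α′} → Coprime α α′ →
  PrimeFactors≤ P α → PrimeFactors≥ Q α → PrimeFactors≤ Q α′ → PrimeFactors≥ P α′ →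
  α ≡ 1 ⊎ α′ ≡ 1
coprime-squeezed⇒≡1 {α = α} {α′} cop α≤P α≥Q α′≤Q α′≥P with α ≟ 1 | α′ ≟ 1
... | yes α≡1 | _        = inj₁ α≡1
... | _       | yes α′≡1 = inj₂ α′≡1
... | no α≢1  | no α′≢1  with primeFactor α≢1 | primeFactor α′≢1
...   | p , p-prime , p∣α | q , q-prime , q∣α′ =
  contradiction (subst Prime (cop (p∣α , subst (_∣ α′) (sym p≡q) q∣α′)) p-prime) ¬prime[1]
  where
  p≡q : p ≡ q
  p≡q = ≤-antisym (≤-trans (α≤P p p-prime p∣α) (α′≥P q q-prime q∣α′))
                  (≤-trans (α′≤Q q q-prime q∣α′) (α≥Q p p-prime p∣α))

smooth-rough-comparable : ∀ {P Q a a′ b b′} .{{_ : NonZero a}} →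
  PrimeFactors≤ P a → PrimeFactors≥ P b → PrimeFactors≤ Q a′ → PrimeFactors≥ Q b′ →
  b * a ≡ b′ * a′ →
  (∃[ c ] a′ ≡ c * a × c ∣ b) ⊎ (∃[ c ] a ≡ c * a′ × c ∣ b′)
smooth-rough-comparable {P} {Q} {a} {a′} {b} {b′} a≤P b≥P a′≤Q b′≥Q ba≡b′a′ =
  [ inj₁ ∘ α≡1⇒a∣a′ , inj₂ ∘ α′≡1⇒a′∣a ]′
    (coprime-squeezed⇒≡1 cop
      (λ p p-prime p∣α → a≤P p p-prime (∣-trans p∣α α∣a))
      (λ p p-prime p∣α → b′≥Q p p-prime (∣-trans p∣α α∣b′))
      (λ p p-prime p∣α′ → a′≤Q p p-prime (∣-trans p∣α′ α′∣a′))
      (λ p p-prime p∣α′ → b≥P p p-prime (∣-trans p∣α′ α′∣b)))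
  where
  g : ℕ
  g = gcd a a′

  instance
    g≢0 : NonZero g
    g≢0 = ≢-nonZero (gcd[m,n]≢0 a a′ (inj₁ (≢-nonZero⁻¹ a)))

  α α′ : ℕ
  α = a / g
  α′ = a′ / g

  a≡αg : a ≡ α * g
  a≡αg = sym (m/n*n≡m (gcd[m,n]∣m a a′))
  a′≡α′g : a′ ≡ α′ * g
  a′≡α′g = sym (m/n*n≡m (gcd[m,n]∣n a a′))

  α∣a : α ∣ a
  α∣a = divides g (trans a≡αg (*-comm α g))
  α′∣a′ : α′ ∣ a′
  α′∣a′ = divides g (trans a′≡α′g (*-comm α′ g))

  cop : Coprime α α′
  cop = coprime-/gcd a a′

  bα≡b′α′ : b * α ≡ b′ * α′
  bα≡b′α′ = *-cancelʳ-≡ (b * α) (b′ * α′) g (begin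
    b * α * g     ≡⟨ *-assoc b α g ⟩
    b * (α * g)   ≡⟨ cong (b *_) a≡αg ⟨
    b * a         ≡⟨ ba≡b′a′ ⟩
    b′ * a′       ≡⟨ cong (b′ *_) a′≡α′g ⟩
    b′ * (α′ * g) ≡⟨ *-assoc b′ α′ g ⟨
    b′ * α′ * g   ∎)
    where open ≡-Reasoning

  α∣b′×α′∣b : α ∣ b′ × α′ ∣ b
  α∣b′×α′∣b = coprime-cross-∣ cop bα≡b′α′

  α∣b′ : α ∣ b′
  α∣b′ = proj₁ α∣b′×α′∣b
  α′∣b : α′ ∣ b
  α′∣b = proj₂ α∣b′×α′∣b

  α≡1⇒a∣a′ : α ≡ 1 → ∃[ c ] a′ ≡ c * a × c ∣ b
  α≡1⇒a∣a′ α≡1 = α′ , trans a′≡α′g (cong (α′ *_) g≡a) , α′∣b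
    where
    g≡a : g ≡ a
    g≡a = sym (trans a≡αg (trans (cong (_* g) α≡1) (*-identityˡ g)))

  α′≡1⇒a′∣a : α′ ≡ 1 → ∃[ c ] a ≡ c * a′ × c ∣ b′
  α′≡1⇒a′∣a α′≡1 = α , trans a≡αg (cong (α *_) g≡a′) , α∣b′
    where
    g≡a′ : g ≡ a′
    g≡a′ = sym (trans a′≡α′g (trans (cong (_* g) α′≡1) (*-identityˡ g)))

factorsAbove-∣ : ∀ {a b c} → c ∣ b → FactorsAbove a b → FactorsAbove a c
factorsAbove-∣ c∣b fb P LP p p-prime p∣c = fb P LP p p-prime (∣-trans p∣c c∣b)

factorsAbove? : ∀ {a P} → IsLargestPrimeFactor a P → ∀ b → Dec (FactorsAbove a b)
factorsAbove? {a} {P} LP b = map′ toFactorsAbove (λ fb → fb P LP) (primeFactors≥? P b)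
  where
  toFactorsAbove : PrimeFactors≥ P b → FactorsAbove a b
  toFactorsAbove b≥P P′ LP′ = subst (λ x → PrimeFactors≥ x b) (largestPrimeFactor-unique LP LP′) b≥P

∈L? : ∀ n a → 1 < a → Dec (n ∈L a)
∈L? n a 1<a@(s<s z<s) with a ∣? n | largestPrimeFactor a 1<a
... | no a∤n | _ = no λ (b , _ , n≡ba , _) → a∤n (divides b n≡ba)
... | yes (divides c n≡ca) | P , LP =
  map′ (λ (1≤c , fc) → c , 1≤c , n≡ca , fc) fromMember (1 ≤? c ×-dec factorsAbove? LP c)
  where
  fromMember : n ∈L a → 1 ≤ c × FactorsAbove a c
  fromMember (b , 1≤b , n≡ba , fb) = subst (λ x → 1 ≤ x × FactorsAbove a x) b≡c (1≤b , fb)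
    where
    b≡c : b ≡ c
    b≡c = *-cancelʳ-≡ b c a (trans (sym n≡ba) n≡ca)

∈L-trans : ∀ {n a a′} → 1 < a′ → n ∈L a′ → a′ ∈L a → n ∈L a
∈L-trans {n} {a} {a′} 1<a′ (b , 1≤b , n≡ba′ , fb) (c , 1≤c , a′≡ca , fc) =
  b * c , *-mono-≤ 1≤b 1≤c , n≡bca , fbc
  where
  n≡bca : n ≡ b * c * a
  n≡bca = trans n≡ba′ (trans (cong (b *_) a′≡ca) (sym (*-assoc b c a)))

  fbc : FactorsAbove a (b * c)
  fbc P LP p p-prime p∣bc with largestPrimeFactor a′ 1<a′
  ... | Q , LQ@(_ , _ , a′≤Q) =
    [ (λ p∣b → ≤-trans P≤Q (fb Q LQ p p-prime p∣b)) , fc P LP p p-prime ]′ (euclidsLemma b c p-prime p∣bc)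
    where
    P≤Q : P ≤ Q
    P≤Q = a′≤Q P (proj₁ LP) (subst (P ∣_) (sym a′≡ca) (∣-trans (proj₁ (proj₂ LP)) (n∣m*n c)))

∈L-comparable : ∀ {n a a′} → 1 < a → 1 < a′ → n ∈L a → n ∈L a′ → a ∈L a′ ⊎ a′ ∈L a
∈L-comparable {a = a} {a′} 1<a@(s<s z<s) 1<a′@(s<s z<s) (b , _ , n≡ba , fb) (b′ , _ , n≡b′a′ , fb′)
  with largestPrimeFactor a 1<a | largestPrimeFactor a′ 1<a′
... | P , LP@(_ , _ , a≤P) | Q , LQ@(_ , _ , a′≤Q) =
  [ inj₂ ∘ member fb , inj₁ ∘ member fb′ ]′
    (smooth-rough-comparable a≤P (fb P LP) a′≤Q (fb′ Q LQ) (trans (sym n≡ba) n≡b′a′))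
  where
  member : ∀ {m k d} .{{_ : NonZero m}} → FactorsAbove k d → ∃[ c ] m ≡ c * k × c ∣ d → m ∈L k
  member {m} fd (c , m≡ck , c∣d) = c , 1≤c , m≡ck , factorsAbove-∣ c∣d fd
    where
    1≤c : 1 ≤ c
    1≤c = >-nonZero⁻¹ c {{m*n≢0⇒m≢0 c {{subst NonZero m≡ck it}}}}

lemma2p1 : (a a' : ℕ) → 1 < a → 1 < a' →
    ((∃ λ n → n ∈L a × n ∈L a') → a ∈L a' ⊎ a' ∈L a)
    × (DisjointL a a' ⊎ (a ⊆L a' ⊎ a' ⊆L a))
lemma2p1 a a′ 1<a 1<a′ = comparable , trichotomy
  where
  comparable : (∃ λ n → n ∈L a × n ∈L a′) → a ∈L a′ ⊎ a′ ∈L a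
  comparable (_ , n∈La , n∈La′) = ∈L-comparable 1<a 1<a′ n∈La n∈La′

  trichotomy : DisjointL a a′ ⊎ (a ⊆L a′ ⊎ a′ ⊆L a)
  trichotomy with ∈L? a a′ 1<a′ | ∈L? a′ a 1<a
  ... | yes a∈La′ | _          = inj₂ (inj₁ λ _ n∈La → ∈L-trans 1<a n∈La a∈La′)
  ... | _         | yes a′∈La  = inj₂ (inj₂ λ _ n∈La′ → ∈L-trans 1<a′ n∈La′ a′∈La)
  ... | no a∉La′  | no a′∉La   = inj₁ λ n n∈La n∈La′ → [ a∉La′ , a′∉La ]′ (comparable (n , n∈La , n∈La′))
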